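{- Let $\mathfrak U$ be the unfolding of a system $M$ under an unconditional independence relation $I$, assumed finite, and let $\tilde C$ be a maximal configuration of $\mathfrak U$. Then in any execution of the procedure Explore described below (started with $\mathrm{Explore}(\{\bot\},\emptyset,\emptyset)$), $\mathrm{Explore}$ is called at most once with first argument equal to $\tilde C$.
   Context: $\mathfrak U=(E,<,\#,h)$ is a labelled event structure (causality $<$ a strict partial order with finite down-sets, conflict $\#$ symmetric irreflexive and inherited along $<$) with a special minimal event $\bot$; a configuration is a finite causally closed conflict-free set of events; $[e]=\{e'\le e\}$, $\lceil e\rceil=\{e'<e\}$; $e\#_ie'$ (immediate conflict) if $e\#e'$ and both $\lceil e\rceil\cup[e']$ and $[e]\cup\lceil e'\rceil$ are configurations. For a configuration $C$: $\mathrm{ex}(C)=\{e\notin C:\lceil e\rceil\subseteq C\}$, $\mathrm{en}(C)=\{e\in\mathrm{ex}(C):C\cup\{e\}\text{ is a configuration}\}$. For $U\subseteq E$, $\#_U(e)=\{e'\in U:e\#_ie'\}$. Given $U$, a configuration $C\subseteq U$ and $D\subseteq U$, an alternative to $D$ after $C$ is a configuration $J\subseteq U$ such that $C\cup J$ is a configuration and for every $e\in D$ some $e'\in C\cup J$ lies in $\#_U(e)$; $\mathrm{Alt}(X,Y)$ is the set of all alternatives (w.r.t. the current global $U$) to $Y$ after $X$. $Q_{C,D,U}=C\cup D\cup\bigcup_{e\in C\cup D,\,e'\in\#_U(e)}[e']$. Algorithm: global sets $U$ (initially $\{\bot\}$) and $G$ (initially $\emptyset$). $\mathrm{Explore}(C,D,A)$: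 (1) add $\mathrm{ex}(C)$ to $U$; (2) if $\mathrm{en}(C)\cap U=\emptyset$, return; (3) if $A=\emptyset$ choose any $e\in\mathrm{en}(C)\cap U$, else any $e\in A\cap\mathrm{en}(C)\cap U$; (4) call $\mathrm{Explore}(C\cup\{e\},D,A\setminus\{e\})$; (5) if some $J\in\mathrm{Alt}(C,D\cup\{e\})$ exists, call $\mathrm{Explore}(C,D\cup\{e\},J\setminus C)$; (6) move $\{e\}\setminus Q_{C,D,U}$ from $U$ to $G$ and, for each $\hat e\in\#_U(e)$, move $[\hat e]\setminus Q_{C,D,U}$ from $U$ to $G$. -}

module Defs where

open import Data.Nat using (ℕ; _<_)
open import Data.Fin using (Fin; toℕ)
open import Data.Fin.Subset using (Subset; _∈_; _∉_; _⊆_; _∪_; _∩_; _─_; _-_; ⁅_⁆)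
open import Data.List using (List; []; _∷_; _++_; map; length; lookup)
open import Data.List.Relation.Unary.Unique.Propositional using (Unique)
import Data.List.Membership.Propositional as ListMem
open import Data.Maybe using (Maybe; just; nothing; _>>=_)
open import Data.Product using (Σ; Σ-syntax; _×_; _,_)
open import Data.Sum using (_⊎_)
open import Relation.Nullary using (¬_)
open import Relation.Binary.PropositionalEquality using (_≡_; _≢_)

infix 2 _⟺_
_⟺_ : Set → Set → Set
A ⟺ B = (A → B) × (B → A)

record System : Set₁ where
  field
    State : Set
    Trans : Set
    s₀    : State
    fire  : Trans → State → Maybe State

module _ (M : System) where
  open System M

  enabled : Trans → State → Set
  enabled t s = Σ[ s' ∈ State ] fire t s ≡ just s'

  run : State → List Trans → Maybe State
  run s []       = just s
  run s (t ∷ ts) = fire t s >>= λ s' → run s' ts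

  record UncondIndep (I : Trans → Trans → Set) : Set where
    field
      sym     : ∀ {t t'} → I t t' → I t' t
      irrefl  : ∀ {t} → ¬ I t t
      enab    : ∀ {t t'} → I t t' → ∀ s s₁ → fire t s ≡ just s₁ →
                enabled t' s ⟺ enabled t' s₁
      commute : ∀ {t t'} → I t t' → ∀ s s₁ s₂ →
                fire t s ≡ just s₁ → fire t' s ≡ just s₂ →
                fire t' s₁ ≡ fire t s₂

record LES (T : Set) (n : ℕ) : Set₁ where
  infix 4 _≺_ _#_
  field
    _≺_    : Fin n → Fin n → Set
    _#_    : Fin n → Fin n → Set
    h      : Fin n → T               -- labelling (value at bot irrelevant)
    bot    : Fin n
    ≺-irrefl : ∀ {e} → ¬ (e ≺ e)
    ≺-trans  : ∀ {e₁ e₂ e₃} → e₁ ≺ e₂ → e₂ ≺ e₃ → e₁ ≺ e₃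
    #-sym    : ∀ {e e'} → e # e' → e' # e
    #-irrefl : ∀ {e} → ¬ (e # e)
    #-inh    : ∀ {e e' e''} → e # e' → e' ≺ e'' → e # e''
    bot-min  : ∀ {e} → ¬ (e ≺ bot)

module ES {T : Set} {n : ℕ} (𝔘 : LES T n) where
  open LES 𝔘

  infix 4 _≼_ _#ᵢ_
  _≼_ : Fin n → Fin n → Set
  x ≼ e = x ≡ e ⊎ x ≺ e

  -- configurations (sets given as predicates; finiteness is automatic)
  Config : (Fin n → Set) → Set
  Config P = (∀ e e' → e' ≺ e → P e → P e') × (∀ e e' → P e → P e' → ¬ (e # e'))

  ConfigS : Subset n → Set
  ConfigS C = Config (_∈ C)

  MaximalConfig : Subset n → Set
  MaximalConfig C = ConfigS C × (∀ C' → ConfigS C' → C ⊆ C' → C' ⊆ C)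

  MaxIn : (Fin n → Set) → Fin n → Set
  MaxIn P e = P e × (∀ e' → P e' → ¬ (e ≺ e'))

  _#ᵢ_ : Fin n → Fin n → Set
  e #ᵢ e' = (e # e') × Config (λ x → x ≺ e ⊎ x ≼ e') × Config (λ x → x ≼ e ⊎ x ≺ e')

  ex : Subset n → Fin n → Set
  ex C e = e ∉ C × (∀ x → x ≺ e → x ∈ C)

  en : Subset n → Fin n → Set
  en C e = ex C e × Config (λ x → x ∈ C ⊎ x ≡ e)

-- The unfolding of M under I (Definition of the paper, written out as the
-- characterisation of the result of the fixpoint construction: events
-- other than ⊥ are exactly the pairs ⟨t , H⟩ with H = ⌈e⌉ a configuration
-- containing ⊥, t enabled at state(H), t dependent on every maximal
-- non-⊥ event of H; conflict is the inherited closure of the conflicts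
-- created by the construction between concurrent dependent events).

module _ (M : System) (I : System.Trans M → System.Trans M → Set) where
  open System M

  module _ {n : ℕ} (𝔘 : LES Trans n) where
    open LES 𝔘
    open ES 𝔘

    -- s is state(C): s is reached by executing the labels of a
    -- linearisation of the non-⊥ events of C
    StateOf : (Fin n → Set) → State → Set
    StateOf P s =
      Σ[ ℓ ∈ List (Fin n) ]
        Unique ℓ
        × (∀ e → ListMem._∈_ e ℓ ⟺ (P e × e ≢ bot))
        × (∀ (i j : Fin (length ℓ)) → lookup ℓ j ≺ lookup ℓ i → toℕ j < toℕ i)
        × run M s₀ (map h ℓ) ≡ just s

    record IsUnfolding : Set where
      field
        bot-least : ∀ e → e ≢ bot → bot ≺ e
        hist-conf : ∀ e → e ≢ bot → Config (λ x → x ≺ e)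
        hist-enab : ∀ e → e ≢ bot →
                    Σ[ s ∈ State ] StateOf (λ x → x ≺ e) s × enabled M (h e) s
        hist-dep  : ∀ e → e ≢ bot → ∀ e' → MaxIn (λ x → x ≺ e) e' → e' ≢ bot →
                    ¬ I (h e) (h e')
        complete  : ∀ (C : Subset n) (t : Trans) → ConfigS C → bot ∈ C →
                    (Σ[ s ∈ State ] StateOf (_∈ C) s × enabled M t s) →
                    (∀ e' → MaxIn (_∈ C) e' → e' ≢ bot → ¬ I t (h e')) →
                    Σ[ e ∈ Fin n ] e ≢ bot × h e ≡ t × (∀ x → x ≺ e ⟺ x ∈ C)
        unique    : ∀ e e' → e ≢ bot → e' ≢ bot → h e ≡ h e' →
                    (∀ x → x ≺ e ⟺ x ≺ e') → e ≡ e'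
        conflict  : ∀ e e' → (e # e') ⟺
                    (Σ[ d ∈ Fin n ] Σ[ d' ∈ Fin n ]
                       d ≼ e × d' ≼ e' × d ≢ bot × d' ≢ bot × d ≢ d'
                       × ¬ (d ≺ d') × ¬ (d' ≺ d) × ¬ I (h d) (h d'))

-- The procedure Explore, as a relational (big-step) semantics of its
-- possibly truncated executions.

module Explore {T : Set} {n : ℕ} (𝔘 : LES T n) where
  open LES 𝔘
  open ES 𝔘

  #[_]_∋_ : Subset n → Fin n → Fin n → Set
  #[ U ] e ∋ e' = e' ∈ U × e #ᵢ e'

  Alt : Subset n → Subset n → Subset n → Subset n → Set
  Alt U C D J = J ⊆ U × ConfigS J × ConfigS (C ∪ J)
              × (∀ e → e ∈ D → Σ[ e' ∈ Fin n ] (e' ∈ C ⊎ e' ∈ J) × #[ U ] e ∋ e')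

  Q : Subset n → Subset n → Subset n → Fin n → Set
  Q U C D x = x ∈ C ⊎ x ∈ D
            ⊎ Σ[ y ∈ Fin n ] Σ[ e' ∈ Fin n ] (y ∈ C ⊎ y ∈ D) × #[ U ] y ∋ e' × x ≼ e'

  -- events moved from U to G in step (6)
  Removed : Subset n → Subset n → Subset n → Fin n → Fin n → Set
  Removed U C D e x = ¬ Q U C D x × (x ≡ e ⊎ Σ[ ê ∈ Fin n ] #[ U ] e ∋ ê × x ≼ ê)

  Step1 : Subset n → Subset n → Subset n → Set
  Step1 U C U' = ∀ x → x ∈ U' ⟺ (x ∈ U ⊎ ex C x)

  Choice : Subset n → Subset n → Subset n → Fin n → Set
  Choice U' C A e = e ∈ U' × en C e × ((∀ x → x ∉ A) ⊎ e ∈ A)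

  Step6 : Subset n → Subset n → Subset n → Subset n → Fin n →
          Subset n → Subset n → Set
  Step6 U G C D e U' G' =
    (∀ x → x ∈ U' ⟺ (x ∈ U × ¬ Removed U C D e x))
    × (∀ x → x ∈ G' ⟺ (x ∈ G ⊎ Removed U C D e x))

  -- result of a (possibly truncated) execution: final globals (U , G),
  -- or "cut" if the execution was interrupted
  data Outcome : Set where
    done : Subset n → Subset n → Outcome
    cut  : Outcome

  -- Exec U G C D A cs o : starting with global sets U, G, the call
  -- Explore(C, D, A) has an execution (or an interrupted prefix of one)
  -- during which the first arguments of all calls of Explore (this one
  -- included), in order, are the list cs, with outcome o.
  data Exec : Subset n → Subset n → Subset n → Subset n → Subset n →
              List (Subset n) → Outcome → Set
  -- steps (5) and (6), after the left call returned with globals U, G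
  data Rest (C D : Subset n) (e : Fin n) : Subset n → Subset n →
            List (Subset n) → Outcome → Set

  data Exec where
    interrupt : ∀ {U G C D A} → Exec U G C D A (C ∷ []) cut
    return    : ∀ {U G C D A U'} → Step1 U C U' →
                (∀ x → en C x → x ∉ U') →
                Exec U G C D A (C ∷ []) (done U' G)
    left-cut  : ∀ {U G C D A U' e cs} → Step1 U C U' → Choice U' C A e →
                Exec U' G (C ∪ ⁅ e ⁆) D (A - e) cs cut →
                Exec U G C D A (C ∷ cs) cut
    branch    : ∀ {U G C D A U' e cs U₁ G₁ cs' o} →
                Step1 U C U' → Choice U' C A e →
                Exec U' G (C ∪ ⁅ e ⁆) D (A - e) cs (done U₁ G₁) →
                Rest C D e U₁ G₁ cs' o →
                Exec U G C D A (C ∷ cs ++ cs') o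

  data Rest C D e where
    no-alt    : ∀ {U G U' G'} →
                (∀ J → ¬ Alt U C (D ∪ ⁅ e ⁆) J) →
                Step6 U G C D e U' G' →
                Rest C D e U G [] (done U' G')
    alt-cut   : ∀ {U G J cs} → Alt U C (D ∪ ⁅ e ⁆) J →
                Exec U G C (D ∪ ⁅ e ⁆) (J ─ C) cs cut →
                Rest C D e U G cs cut
    alt       : ∀ {U G J cs U₂ G₂ U' G'} → Alt U C (D ∪ ⁅ e ⁆) J →
                Exec U G C (D ∪ ⁅ e ⁆) (J ─ C) cs (done U₂ G₂) →
                Step6 U₂ G₂ C D e U' G' →
                Rest C D e U G cs (done U' G')

-- Every call of Explore(C, D, A) satisfies the invariant that C ∪ A is a
-- configuration and each event of D is in conflict with an event of C ∪ A;
-- in particular D ∩ C = ∅. Along the recursion C only grows and D only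
-- grows, so every call issued while running Explore(C, D, A) has a first
-- argument Y with C ⊆ Y and D ∩ Y = ∅. At a branching on e, the first
-- arguments of the left subtree all contain e while those of the right
-- subtree (where e has been added to D) all avoid e, so a fixed set C̃
-- occurs in at most one of the two subtrees; and the branching call itself
-- has an enabled event, so its first argument is not maximal.
module Submission where

open import Defs
open import Data.Nat using (ℕ)
open import Data.Fin using (Fin; zero; suc; _≟_)
open import Data.Fin.Subset using (Subset; ⁅_⁆; ⊥; _∈_; _∉_; _⊆_; _∪_; _─_; _-_)
open import Data.Fin.Subset.Properties
  using (x∈p∪q⁻; x∈p∪q⁺; p⊆p∪q; q⊆p∪q; x∈⁅x⁆; x∈⁅y⁆⇒x≡y; p─q⊆p;
         x∈p∧x∉q⇒x∈p─q; x∈p∧x≢y⇒x∈p-y; _∈?_; ∉⊥; ⊆-refl; ∪-identityʳ)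
open import Data.List using (List; []; _∷_; _++_; length; lookup)
open import Data.List.Relation.Unary.All as All using (All; []; _∷_)
open import Data.List.Relation.Unary.All.Properties using (++⁺)
open import Data.List.Membership.Propositional.Properties using (∈-lookup)
open import Data.Product using (Σ-syntax; _×_; _,_; proj₁; proj₂)
open import Data.Sum using (_⊎_; inj₁; inj₂)
import Data.Sum as Sum
open import Data.Unit.Polymorphic using (⊤)
open import Level using (Level)
open import Relation.Nullary using (¬_; yes; no; contradiction)
open import Relation.Unary using (Pred; Decidable; ∁)
open import Relation.Binary.PropositionalEquality using (_≡_; _≢_; refl; sym; cong; subst)

module _ {a : Level} {A : Set a} where

  AtMostOnce : A → List A → Set a
  AtMostOnce x []       = ⊤
  AtMostOnce x (y ∷ ys) = (y ≡ x → All (_≢ x) ys) × AtMostOnce x ys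

  atMostOnce-++⁺ : ∀ {x} xs {ys} → AtMostOnce x xs → AtMostOnce x ys →
                   All (_≢ x) xs ⊎ All (_≢ x) ys → AtMostOnce x (xs ++ ys)
  atMostOnce-++⁺ []       _               once-ys _                  = once-ys
  atMostOnce-++⁺ (y ∷ xs) (_ , once-xs)   once-ys (inj₁ (y≢x ∷ xs≢x)) =
    (λ y≡x → contradiction y≡x y≢x) , atMostOnce-++⁺ xs once-xs once-ys (inj₁ xs≢x)
  atMostOnce-++⁺ (y ∷ xs) (last , once-xs) once-ys (inj₂ ys≢x) =
    (λ y≡x → ++⁺ (last y≡x) ys≢x) , atMostOnce-++⁺ xs once-xs once-ys (inj₂ ys≢x)

  all⇒≢ : ∀ {ℓ} {P : Pred A ℓ} {x} {xs} → All P xs → ¬ P x → All (_≢ x) xs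
  all⇒≢ {P = P} {x} ps ¬px = All.map (λ py y≡x → ¬px (subst P y≡x py)) ps

  atMostOnce-++⁺-separated : ∀ {ℓ} {P : Pred A ℓ} → Decidable P →
                             ∀ {x} xs {ys} → All P xs → All (∁ P) ys →
                             AtMostOnce x xs → AtMostOnce x ys →
                             AtMostOnce x (xs ++ ys)
  atMostOnce-++⁺-separated P? {x} xs ps ¬ps once-xs once-ys with P? x
  ... | yes px = atMostOnce-++⁺ xs once-xs once-ys (inj₂ (all⇒≢ ¬ps (λ ¬px → ¬px px)))
  ... | no ¬px = atMostOnce-++⁺ xs once-xs once-ys (inj₁ (all⇒≢ ps ¬px))

  atMostOnce⇒lookup-injective : ∀ {x} xs → AtMostOnce x xs →
                                (i j : Fin (length xs)) →
                                lookup xs i ≡ x → lookup xs j ≡ x → i ≡ j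
  atMostOnce⇒lookup-injective (y ∷ ys) _           zero    zero    _    _    = refl
  atMostOnce⇒lookup-injective (y ∷ ys) (last , _)  zero    (suc j) y≡x  yj≡x =
    contradiction yj≡x (All.lookup (last y≡x) (∈-lookup j))
  atMostOnce⇒lookup-injective (y ∷ ys) (last , _)  (suc i) zero    yi≡x y≡x  =
    contradiction yi≡x (All.lookup (last y≡x) (∈-lookup i))
  atMostOnce⇒lookup-injective (y ∷ ys) (_ , once) (suc i) (suc j) yi≡x yj≡x =
    cong suc (atMostOnce⇒lookup-injective ys once i j yi≡x yj≡x)

module _ {n : ℕ} where

  ∪-lub : {p q r : Subset n} → p ⊆ r → q ⊆ r → p ∪ q ⊆ r
  ∪-lub {p} {q} p⊆r q⊆r x∈p∪q = Sum.[ p⊆r , q⊆r ] (x∈p∪q⁻ p q x∈p∪q)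

  ⁅⁆⊆ : ∀ {x} {p : Subset n} → x ∈ p → ⁅ x ⁆ ⊆ p
  ⁅⁆⊆ {x} {p} x∈p y∈⁅x⁆ = subst (_∈ p) (sym (x∈⁅y⁆⇒x≡y x y∈⁅x⁆)) x∈p

  ∪⊆∪⁅⁆∪- : ∀ (p q : Subset n) x → p ∪ q ⊆ (p ∪ ⁅ x ⁆) ∪ (q - x)
  ∪⊆∪⁅⁆∪- p q x {y} y∈p∪q with x∈p∪q⁻ p q y∈p∪q | y ≟ x
  ... | inj₁ y∈p | _       = p⊆p∪q _ (p⊆p∪q _ y∈p)
  ... | inj₂ _   | yes refl = p⊆p∪q _ (q⊆p∪q p _ (x∈⁅x⁆ y))
  ... | inj₂ y∈q | no y≢x  = q⊆p∪q _ _ (x∈p∧x≢y⇒x∈p-y y∈q y≢x)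

  ∪⊆∪─ : ∀ (p q : Subset n) → p ∪ q ⊆ p ∪ (q ─ p)
  ∪⊆∪─ p q {y} y∈p∪q with x∈p∪q⁻ p q y∈p∪q | y ∈? p
  ... | inj₁ y∈p | _       = p⊆p∪q _ y∈p
  ... | inj₂ _   | yes y∈p = p⊆p∪q _ y∈p
  ... | inj₂ y∈q | no y∉p  = q⊆p∪q p _ (x∈p∧x∉q⇒x∈p─q y∈q y∉p)

module Exploration {T : Set} {n : ℕ} (𝔘 : LES T n) where
  open LES 𝔘
  open ES 𝔘
  open Explore 𝔘

  config-cong : ∀ {P Q : Fin n → Set} →
                (∀ {x} → P x → Q x) → (∀ {x} → Q x → P x) → Config P → Config Q
  config-cong P⊆Q Q⊆P (closed , conflict-free) =
    (λ e e' e'≺e qe → P⊆Q (closed e e' e'≺e (Q⊆P qe))) ,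
    (λ e e' qe qe' → conflict-free e e' (Q⊆P qe) (Q⊆P qe'))

  config-⁅bot⁆ : ConfigS ⁅ bot ⁆
  config-⁅bot⁆ = closed , conflict-free
    where
    closed : ∀ e e' → e' ≺ e → e ∈ ⁅ bot ⁆ → e' ∈ ⁅ bot ⁆
    closed e e' e'≺e e∈⁅bot⁆ with x∈⁅y⁆⇒x≡y bot e∈⁅bot⁆
    ... | refl = contradiction e'≺e bot-min
    conflict-free : ∀ e e' → e ∈ ⁅ bot ⁆ → e' ∈ ⁅ bot ⁆ → ¬ (e # e')
    conflict-free e e' e∈⁅bot⁆ e'∈⁅bot⁆
      with x∈⁅y⁆⇒x≡y bot e∈⁅bot⁆ | x∈⁅y⁆⇒x≡y bot e'∈⁅bot⁆
    ... | refl | refl = #-irrefl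

  en⇒config-∪⁅⁆ : ∀ {C e} → en C e → ConfigS (C ∪ ⁅ e ⁆)
  en⇒config-∪⁅⁆ {C} {e} (_ , config) = config-cong into outof config
    where
    into : ∀ {x} → x ∈ C ⊎ x ≡ e → x ∈ C ∪ ⁅ e ⁆
    into (inj₁ x∈C) = p⊆p∪q _ x∈C
    into (inj₂ refl) = q⊆p∪q C _ (x∈⁅x⁆ e)
    outof : ∀ {x} → x ∈ C ∪ ⁅ e ⁆ → x ∈ C ⊎ x ≡ e
    outof x∈C∪e = Sum.map₂ (x∈⁅y⁆⇒x≡y e) (x∈p∪q⁻ C _ x∈C∪e)

  maximal⇒¬en : ∀ {C e} → MaximalConfig C → ¬ en C e
  maximal⇒¬en {C} (_ , maximal) en-e@((e∉C , _) , _) =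
    e∉C (maximal _ (en⇒config-∪⁅⁆ en-e) (p⊆p∪q _) (q⊆p∪q C _ (x∈⁅x⁆ _)))

  Invariant : Subset n → Subset n → Subset n → Set
  Invariant C D A = ConfigS (C ∪ A) × (∀ d → d ∈ D → Σ[ e ∈ Fin n ] e ∈ C ∪ A × d # e)

  ExtendsAvoiding : Subset n → Subset n → Subset n → Set
  ExtendsAvoiding C D Y = C ⊆ Y × (∀ {d} → d ∈ D → d ∉ Y)

  extendsAvoiding-anti : ∀ {C C' D D' Y} → C' ⊆ C → D' ⊆ D →
                         ExtendsAvoiding C D Y → ExtendsAvoiding C' D' Y
  extendsAvoiding-anti C'⊆C D'⊆D (C⊆Y , avoids-D) =
    (λ x∈C' → C⊆Y (C'⊆C x∈C')) , (λ d∈D' → avoids-D (D'⊆D d∈D'))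

  invariant⇒extendsAvoiding : ∀ {C D A} → Invariant C D A → ExtendsAvoiding C D C
  invariant⇒extendsAvoiding {C} (config , conflicting) = ⊆-refl , λ {d} d∈D d∈C →
    let (e , e∈C∪A , d#e) = conflicting d d∈D
    in proj₂ config d e (p⊆p∪q _ d∈C) e∈C∪A d#e

  invariant-initial : Invariant ⁅ bot ⁆ ⊥ ⊥
  invariant-initial = subst ConfigS (sym (∪-identityʳ ⁅ bot ⁆)) config-⁅bot⁆ ,
                      λ d d∈⊥ → contradiction d∈⊥ ∉⊥

  invariant-left : ∀ {U C D A e} → Invariant C D A → Choice U C A e →
                   Invariant (C ∪ ⁅ e ⁆) D (A - e)
  invariant-left {C = C} {A = A} {e} (config , conflicting) (_ , en-e , A-empty⊎e∈A) =
    config' A-empty⊎e∈A ,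
    λ d d∈D → let (e' , e'∈C∪A , d#e') = conflicting d d∈D
              in e' , ∪⊆∪⁅⁆∪- C A e e'∈C∪A , d#e'
    where
    config' : (∀ x → x ∉ A) ⊎ e ∈ A → ConfigS ((C ∪ ⁅ e ⁆) ∪ (A - e))
    config' (inj₁ A-empty) =
      config-cong (p⊆p∪q _)
                  (∪-lub ⊆-refl (λ x∈A-e → contradiction (p─q⊆p A _ x∈A-e) (A-empty _)))
                  (en⇒config-∪⁅⁆ en-e)
    config' (inj₂ e∈A) =
      config-cong (∪⊆∪⁅⁆∪- C A e)
                  (∪-lub (∪-lub (p⊆p∪q _) (⁅⁆⊆ (q⊆p∪q C A e∈A)))
                         (λ x∈A-e → q⊆p∪q C A (p─q⊆p A _ x∈A-e)))
                  config

  invariant-right : ∀ {U C D e J} → Alt U C (D ∪ ⁅ e ⁆) J →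
                    Invariant C (D ∪ ⁅ e ⁆) (J ─ C)
  invariant-right {C = C} {J = J} (_ , _ , config , conflicting) =
    config-cong (∪⊆∪─ C J)
                (∪-lub (p⊆p∪q _) (λ x∈J─C → q⊆p∪q C J (p─q⊆p J C x∈J─C)))
                config ,
    λ d d∈D → let (e' , e'∈C⊎J , (_ , d#ᵢe')) = conflicting d d∈D
              in e' , ∪⊆∪─ C J (x∈p∪q⁺ e'∈C⊎J) , proj₁ d#ᵢe'

  mutual
    exec-extendsAvoiding : ∀ {U G C D A cs o} → Invariant C D A → Exec U G C D A cs o →
                           All (ExtendsAvoiding C D) cs
    exec-extendsAvoiding inv interrupt    = invariant⇒extendsAvoiding inv ∷ []
    exec-extendsAvoiding inv (return _ _) = invariant⇒extendsAvoiding inv ∷ []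
    exec-extendsAvoiding inv (left-cut _ choice left) =
      invariant⇒extendsAvoiding inv ∷
      All.map (extendsAvoiding-anti (p⊆p∪q _) ⊆-refl)
              (exec-extendsAvoiding (invariant-left inv choice) left)
    exec-extendsAvoiding inv (branch _ choice left rest) =
      invariant⇒extendsAvoiding inv ∷
      ++⁺ (All.map (extendsAvoiding-anti (p⊆p∪q _) ⊆-refl)
                   (exec-extendsAvoiding (invariant-left inv choice) left))
          (All.map (extendsAvoiding-anti ⊆-refl (p⊆p∪q _)) (rest-extendsAvoiding rest))

    rest-extendsAvoiding : ∀ {U G C D e cs o} → Rest C D e U G cs o →
                           All (ExtendsAvoiding C (D ∪ ⁅ e ⁆)) cs
    rest-extendsAvoiding (no-alt _ _)          = []
    rest-extendsAvoiding (alt-cut isAlt right) =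
      exec-extendsAvoiding (invariant-right isAlt) right
    rest-extendsAvoiding (alt isAlt right _)   =
      exec-extendsAvoiding (invariant-right isAlt) right

  module _ {C̃ : Subset n} (maximal-C̃ : MaximalConfig C̃) where

    chosen⇒≢maximal : ∀ {U C A e} → Choice U C A e → C ≢ C̃
    chosen⇒≢maximal (_ , en-e , _) refl = maximal⇒¬en maximal-C̃ en-e

    mutual
      exec-atMostOnce : ∀ {U G C D A cs o} → Invariant C D A → Exec U G C D A cs o →
                        AtMostOnce C̃ cs
      exec-atMostOnce _ interrupt    = (λ _ → []) , _
      exec-atMostOnce _ (return _ _) = (λ _ → []) , _
      exec-atMostOnce inv (left-cut _ choice left) =
        (λ C≡C̃ → contradiction C≡C̃ (chosen⇒≢maximal choice)) ,
        exec-atMostOnce (invariant-left inv choice) left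
      exec-atMostOnce {C = C} {D} {A} inv (branch {e = e} {cs = cs} _ choice left rest) =
        (λ C≡C̃ → contradiction C≡C̃ (chosen⇒≢maximal choice)) ,
        atMostOnce-++⁺-separated (e ∈?_) cs
          (All.map (λ (C∪e⊆Y , _) → C∪e⊆Y (q⊆p∪q C _ (x∈⁅x⁆ e))) left-calls)
          (All.map (λ (_ , avoids-D∪e) → avoids-D∪e (q⊆p∪q _ _ (x∈⁅x⁆ e)))
                   (rest-extendsAvoiding rest))
          (exec-atMostOnce inv-left left)
          (rest-atMostOnce rest)
        where
        inv-left : Invariant (C ∪ ⁅ e ⁆) D (A - e)
        inv-left = invariant-left inv choice
        left-calls : All (ExtendsAvoiding (C ∪ ⁅ e ⁆) D) cs
        left-calls = exec-extendsAvoiding inv-left left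

      rest-atMostOnce : ∀ {U G C D e cs o} → Rest C D e U G cs o → AtMostOnce C̃ cs
      rest-atMostOnce (no-alt _ _)          = _
      rest-atMostOnce (alt-cut isAlt right) = exec-atMostOnce (invariant-right isAlt) right
      rest-atMostOnce (alt isAlt right _)   = exec-atMostOnce (invariant-right isAlt) right

theorem3 : (M : System) (I : System.Trans M → System.Trans M → Set) →
           UncondIndep M I →
           (n : ℕ) (𝔘 : LES (System.Trans M) n) → IsUnfolding M I 𝔘 →
           (C̃ : Subset n) → ES.MaximalConfig 𝔘 C̃ →
           (cs : List (Subset n)) (o : Explore.Outcome 𝔘) →
           Explore.Exec 𝔘 ⁅ LES.bot 𝔘 ⁆ ⊥ ⁅ LES.bot 𝔘 ⁆ ⊥ ⊥ cs o →
           (i j : Fin (length cs)) → lookup cs i ≡ C̃ → lookup cs j ≡ C̃ → i ≡ j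
theorem3 M I _ n 𝔘 _ C̃ maximal-C̃ cs o exec =
  atMostOnce⇒lookup-injective cs (exec-atMostOnce maximal-C̃ invariant-initial exec)
  where open Exploration 𝔘
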